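{- Let $G$ be a finite, simple, connected graph with a perfect matching $M$. Let $C=u_{0}u_{1}\ldots u_{2m-1}u_{0}$ be a longest $M$-alternating cycle in $G$, where $u_{2i-1}u_{2i}\in M$ for $0\leq i\leq m-1$ (subscripts taken modulo $2m$). Let $v$, $w$ be the two endvertices of a closed $M$-alternating path in $G-C$. Then for every $0\leq i\leq m-1$: if $G$ is bipartite then $e(\{u_{2i},u_{2i+1}\},\{v,w\})\leq 1$, and otherwise $e(\{u_{2i},u_{2i+1}\},\{v,w\})\leq 2$.
   Context: For disjoint vertex sets $X,Y$, $e(X,Y)$ denotes the number of edges of $G$ with one end in $X$ and the other in $Y$. A matching $M$ is a set of pairwise non-adjacent edges; it is perfect if it covers every vertex. An $M$-alternating path (cycle) is a path (cycle) whose edges lie alternately in $M$ and in $E(G)\setminus M$. A closed $M$-alternating path is either a single edge of $M$ or an $M$-alternating path whose first and last edges belong to $M$. $G-C$ denotes the graph obtained by deleting the vertices of $C$. -}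

module Defs where

open import Data.Nat using (ℕ; zero; suc; _+_; _*_; _∸_; _≤_; _<_)
open import Data.Fin using (Fin)
open import Data.Bool using (Bool; true; false; if_then_else_)
open import Data.List using (List; []; _∷_; map; concatMap)
open import Data.Nat.ListAction using (sum)
open import Data.Product using (Σ; ∃; _×_; _,_)
open import Relation.Binary.PropositionalEquality using (_≡_; _≢_)
open import Relation.Nullary using (¬_)
open import Relation.Binary.Construct.Closure.ReflexiveTransitive using (Star)

record Graph (n : ℕ) : Set where
  field
    adj   : Fin n → Fin n → Bool
    sym   : ∀ x y → adj x y ≡ adj y x
    irrfl : ∀ x → adj x x ≡ false
open Graph public

Edge : ∀ {n} → Graph n → Fin n → Fin n → Set
Edge G x y = adj G x y ≡ true

Connected : ∀ {n} → Graph n → Set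
Connected G = ∀ x y → Star (Edge G) x y

Bipartite : ∀ {n} → Graph n → Set
Bipartite {n} G = Σ (Fin n → Bool) λ c → ∀ x y → Edge G x y → c x ≢ c y

record PerfectMatching {n : ℕ} (G : Graph n) (M : Fin n → Fin n → Bool) : Set where
  field
    symM     : ∀ x y → M x y ≡ M y x
    subE     : ∀ x y → M x y ≡ true → Edge G x y
    disjoint : ∀ x y z → M x y ≡ true → M x z ≡ true → y ≡ z
    covers   : ∀ x → ∃ λ y → M x y ≡ true

-- An M-alternating cycle u₀u₁…u_{2m-1}u₀ of length 2m (m ≥ 2, so length ≥ 4),
-- encoded by a 2m-periodic vertex sequence u : ℕ → Fin n (subscripts mod 2m).
record AltCycle {n : ℕ} (G : Graph n) (M : Fin n → Fin n → Bool) : Set where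
  field
    half     : ℕ
    half≥2   : 2 ≤ half
    u        : ℕ → Fin n
    periodic : ∀ i → u (i + 2 * half) ≡ u i
    distinct : ∀ i j → i < 2 * half → j < 2 * half → u i ≡ u j → i ≡ j
    edges    : ∀ i → Edge G (u i) (u (suc i))
    alt      : ∀ i → M (u i) (u (suc i)) ≢ M (u (suc i)) (u (suc (suc i)))
open AltCycle public

OnCycle : ∀ {n} {G : Graph n} {M} → AltCycle G M → Fin n → Set
OnCycle C x = ∃ λ j → j < 2 * half C × u C j ≡ x

Longest : ∀ {n} {G : Graph n} {M} → AltCycle G M → Set
Longest {G = G} {M} C = ∀ (C' : AltCycle G M) → half C' ≤ half C

record ClosedAltPathAvoiding {n : ℕ} (G : Graph n) (M : Fin n → Fin n → Bool)
       (C : AltCycle G M) (v w : Fin n) : Set where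
  field
    len      : ℕ
    len≥1    : 1 ≤ len
    p        : ℕ → Fin n
    start    : p 0 ≡ v
    end      : p len ≡ w
    distinct : ∀ i j → i ≤ len → j ≤ len → p i ≡ p j → i ≡ j
    edges    : ∀ i → i < len → Edge G (p i) (p (suc i))
    alt      : ∀ i → suc i < len → M (p i) (p (suc i)) ≢ M (p (suc i)) (p (suc (suc i)))
    firstM   : M (p 0) (p 1) ≡ true
    lastM    : M (p (len ∸ 1)) (p len) ≡ true
    avoids   : ∀ i → i ≤ len → ¬ OnCycle C (p i)

-- e(X,Y): the number of edges with one end in X and the other in Y, for
-- disjoint vertex sets X, Y given as duplicate-free lists.
eCount : ∀ {n} → Graph n → List (Fin n) → List (Fin n) → ℕ
eCount G X Y = sum (concatMap (λ x → map (λ y → if adj G x y then 1 else 0) Y) X)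

-- If u_{2i} ~ v and u_{2i+1} ~ w, then replacing the non-matching
-- edge u_{2i}u_{2i+1} of C by the detour u_{2i} v P w u_{2i+1} yields an
-- M-alternating cycle that is longer than C (P has odd length, starts and
-- ends with M-edges, and v, w are matched inside P, so the two new junction
-- edges are not in M).  Reversing P rules out u_{2i} ~ w, u_{2i+1} ~ v in
-- the same way.  So the four possible edges split into two pairs of
-- mutually exclusive ones, giving at most 2.  If G is bipartite, P having
-- odd length forces v, w into different colour classes, as are u_{2i} and
-- u_{2i+1}; then any two of the four edges exclude each other, giving 1.

module Submission where

open import Defs hiding (sym)
open import Data.Nat
  using (ℕ; zero; suc; pred; _+_; _*_; _∸_; _≤_; _<_; _<?_; z≤n; s≤s; s≤s⁻¹; z<s; NonZero; >-nonZero; >-nonZero⁻¹)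
open import Data.Nat.Properties
open import Data.Nat.DivMod
  using (_%_; _/_; m≡m%n+[m/n]*n; m%n<n; m%n≤n; m<n⇒m%n≡m; m%n%n≡m%n; [m+kn]%n≡m%n; [m+n]%n≡m%n;
         %-distribˡ-+; n%n≡0)
open import Data.Nat.Tactic.RingSolver using (solve-∀)
open import Data.Nat.ListAction using (sum)
open import Data.Fin using (Fin)
open import Data.Bool using (Bool; true; false; not; if_then_else_)
open import Data.Bool.Properties using (not-involutive; ¬-not; not-¬)
open import Data.List using ([]; _∷_; map)
open import Data.List.Relation.Unary.All using (All; []; _∷_)
open import Data.List.Relation.Unary.AllPairs using (AllPairs; []; _∷_)
open import Data.Product using (∃; _×_; _,_; proj₁; proj₂)
open import Data.Empty using (⊥; ⊥-elim)
open import Relation.Nullary using (¬_; Dec; yes; no; contradiction)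
open import Relation.Binary.PropositionalEquality

even : ℕ → Bool
even zero    = true
even (suc n) = not (even n)

double-suc : ∀ t → suc (suc (2 * t)) ≡ 2 * suc t
double-suc = solve-∀

even-2*+ : ∀ k b → even (2 * k + b) ≡ even b
even-2*+ zero    b = refl
even-2*+ (suc k) b = begin
  even (2 * suc k + b)          ≡⟨ cong (λ z → even (z + b)) (sym (double-suc k)) ⟩
  not (not (even (2 * k + b)))  ≡⟨ not-involutive _ ⟩
  even (2 * k + b)              ≡⟨ even-2*+ k b ⟩
  even b                        ∎
  where
  open ≡-Reasoning

even-double : ∀ k → even (2 * k) ≡ true
even-double k = trans (cong even (sym (+-identityʳ (2 * k)))) (even-2*+ k 0)

even⇒double : ∀ x → even x ≡ true → ∃ λ t → x ≡ 2 * t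
even⇒double zero          _ = 0 , refl
even⇒double (suc (suc x)) e with even⇒double x (trans (sym (not-involutive (even x))) e)
... | t , refl = suc t , double-suc t

even-pred : ∀ r H → suc r ≡ 2 * H → even r ≡ false
even-pred r H eq = trans (sym (not-involutive (even r)))
                         (cong not (trans (cong even eq) (even-double H)))

alternating : ∀ k (b : ℕ → Bool) → (∀ x → suc x < k → b x ≢ b (suc x)) →
              ∀ x → x < k → b x ≡ (if even x then b 0 else not (b 0))
alternating k b flips zero    _   = refl
alternating k b flips (suc x) x<k =
  trans (¬-not (λ e → flips x x<k (sym e)))
        (trans (cong not (alternating k b flips x (<-trans (n<1+n x) x<k)))
               (not-if (even x) (b 0)))
  where
  not-if : ∀ c y → not (if c then y else not y) ≡ (if not c then y else not y)
  not-if true  y = refl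
  not-if false y = not-involutive y

phase : ∀ k (b : ℕ → Bool) → (∀ x → suc x < k → b x ≢ b (suc x)) →
        b 0 ≡ true → ∀ x → x < k → b x ≡ even x
phase k b flips b0 x x<k with even x | alternating k b flips x x<k
... | true  | e = trans e b0
... | false | e = trans e (cong not b0)

indicator : Bool → ℕ
indicator b = if b then 1 else 0

Exclusive : Bool → Bool → Set
Exclusive x y = x ≡ true → y ≡ true → ⊥

at-most-one : ∀ {xs} → AllPairs Exclusive xs → sum (map indicator xs) ≤ 1
at-most-one [] = z≤n
at-most-one {false ∷ _} (_  ∷ ps) = at-most-one ps
at-most-one {true  ∷ _} (px ∷ _)  = s≤s (≤-reflexive (none-true px))
  where
  none-true : ∀ {ys} → All (Exclusive true) ys → sum (map indicator ys) ≡ 0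
  none-true [] = refl
  none-true {false ∷ _} (_ ∷ qs) = none-true qs
  none-true {true  ∷ _} (q ∷ _)  = ⊥-elim (q refl refl)

two-pairs : ∀ x₁ x₂ x₃ x₄ → Exclusive x₁ x₄ → Exclusive x₂ x₃ →
           sum (map indicator (x₁ ∷ x₂ ∷ x₃ ∷ x₄ ∷ [])) ≤ 2
two-pairs x₁ x₂ x₃ x₄ e₁₄ e₂₃ =
  subst (_≤ 2) (sym (regroup (indicator x₁) (indicator x₂) (indicator x₃) (indicator x₄)))
        (+-mono-≤ (at-most-one ((e₁₄ ∷ []) ∷ [] ∷ [])) (at-most-one ((e₂₃ ∷ []) ∷ [] ∷ [])))
  where
  regroup : ∀ p q r s → p + (q + (r + (s + 0))) ≡ (p + (s + 0)) + (q + (r + 0))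
  regroup = solve-∀

edge-sym : ∀ {n} (G : Graph n) {x y} → Edge G x y → Edge G y x
edge-sym G {x} {y} e = trans (Graph.sym G y x) e

same-side : ∀ {n} (G : Graph n) (c : Fin n → Bool) → (∀ x y → Edge G x y → c x ≢ c y) →
           ∀ {x y z} → Edge G x y → Edge G x z → c y ≡ c z
same-side G c proper {x} xy xz =
  trans (¬-not (λ e → proper x _ xy (sym e)))
        (sym (¬-not (λ e → proper x _ xz (sym e))))

-- Adding a fixed offset is injective modulo L: the offset a has an
-- additive inverse b = L ∸ a % L modulo L.
+-cancelʳ-% : ∀ a s s' L .{{_ : NonZero L}} → (s + a) % L ≡ (s' + a) % L → s % L ≡ s' % L
+-cancelʳ-% a s s' L eq = begin
  s % L                       ≡⟨ undo s ⟩
  (b + (s + a)) % L           ≡⟨ %-distribˡ-+ b (s + a) L ⟩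
  (b % L + (s + a) % L) % L   ≡⟨ cong (λ z → (b % L + z) % L) eq ⟩
  (b % L + (s' + a) % L) % L  ≡⟨ sym (%-distribˡ-+ b (s' + a) L) ⟩
  (b + (s' + a)) % L          ≡⟨ sym (undo s') ⟩
  s' % L                      ∎
  where
  open ≡-Reasoning
  b : ℕ
  b = L ∸ a % L
  inverse : (a + b) % L ≡ 0
  inverse = begin
    (a + b) % L                   ≡⟨ cong (λ z → (z + b) % L) (m≡m%n+[m/n]*n a L) ⟩
    (a % L + a / L * L + b) % L   ≡⟨ cong (_% L) (rotate3 (a % L) (a / L * L) b) ⟩
    (b + a % L + a / L * L) % L   ≡⟨ [m+kn]%n≡m%n (b + a % L) (a / L) L ⟩
    (b + a % L) % L               ≡⟨ cong (_% L) (m∸n+n≡m (m%n≤n a L)) ⟩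
    L % L                         ≡⟨ n%n≡0 L ⟩
    0                             ∎
    where
    rotate3 : ∀ x y z → x + y + z ≡ z + x + y
    rotate3 = solve-∀
  undo : ∀ x → x % L ≡ (b + (x + a)) % L
  undo x = begin
    x % L                      ≡⟨ sym (m%n%n≡m%n x L) ⟩
    (0 + x % L) % L            ≡⟨ cong (λ z → (z + x % L) % L) (sym inverse) ⟩
    ((a + b) % L + x % L) % L  ≡⟨ sym (%-distribˡ-+ (a + b) x L) ⟩
    (a + b + x) % L            ≡⟨ cong (_% L) (reorder a b x) ⟩
    (b + (x + a)) % L          ∎
    where
    reorder : ∀ x y z → x + y + z ≡ y + (z + x)
    reorder = solve-∀

module _ {n} {G : Graph n} {M : Fin n → Fin n → Bool} (C : AltCycle G M) where

  instance
    length-nonZero : NonZero (2 * half C)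
    length-nonZero = >-nonZero (≤-trans (s≤s z≤n) (≤-trans (half≥2 C) (m≤m+n (half C) _)))

  cycle-mod : ∀ x → u C x ≡ u C (x % (2 * half C))
  cycle-mod x = trans (cong (u C) (m≡m%n+[m/n]*n x L)) (shift (x / L) (x % L))
    where
    L : ℕ
    L = 2 * half C
    shift : ∀ k y → u C (y + k * L) ≡ u C y
    shift zero    y = cong (u C) (+-identityʳ y)
    shift (suc k) y = begin
      u C (y + (L + k * L))  ≡⟨ cong (u C) (reorder y L (k * L)) ⟩
      u C (y + k * L + L)    ≡⟨ periodic C (y + k * L) ⟩
      u C (y + k * L)        ≡⟨ shift k y ⟩
      u C y                  ∎
      where
      open ≡-Reasoning
      reorder : ∀ y L m → y + (L + m) ≡ y + m + L
      reorder = solve-∀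

  cycle-index : ∀ {x y} → u C x ≡ u C y → x % (2 * half C) ≡ y % (2 * half C)
  cycle-index {x} {y} e = distinct C (x % L) (y % L) (m%n<n x L) (m%n<n y L)
                                     (trans (sym (cycle-mod x)) (trans e (cycle-mod y)))
    where
    L : ℕ
    L = 2 * half C

  rotate : ℕ → AltCycle G M
  rotate a = record
    { half     = half C
    ; half≥2   = half≥2 C
    ; u        = λ s → u C (s + a)
    ; periodic = λ s → trans (cong (u C) (swap s L a)) (periodic C (s + a))
    ; distinct = λ s s' s<L s'<L e →
        trans (sym (m<n⇒m%n≡m s<L))
              (trans (+-cancelʳ-% a s s' L (cycle-index e)) (m<n⇒m%n≡m s'<L))
    ; edges    = λ s → edges C (s + a)
    ; alt      = λ s → alt C (s + a)
    }
    where
    L : ℕ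
    L = 2 * half C
    swap : ∀ s L a → s + L + a ≡ s + a + L
    swap = solve-∀

  rotate-onCycle : ∀ a {x} → OnCycle (rotate a) x → OnCycle C x
  rotate-onCycle a (j , _ , e) =
    (j + a) % (2 * half C) , m%n<n (j + a) (2 * half C) , trans (sym (cycle-mod (j + a))) e

  rotate-last : ∀ a → u (rotate (suc a)) (pred (2 * half C)) ≡ u C a
  rotate-last a = trans (cong (u C) index) (periodic C a)
    where
    index : pred (2 * half C) + suc a ≡ a + 2 * half C
    index = trans (+-suc _ a) (trans (cong (_+ a) (suc-pred (2 * half C))) (+-comm _ a))

  cycle-phase : M (u C 0) (u C 1) ≡ true → ∀ x → M (u C x) (u C (suc x)) ≡ even x
  cycle-phase m₀₁ x = phase (suc x) (λ y → M (u C y) (u C (suc y))) (λ y _ → alt C y) m₀₁ x ≤-refl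

unmatched-to-cycle : ∀ {n} {G : Graph n} {M} → PerfectMatching G M → (C : AltCycle G M) →
                     ∀ {x y z} → M x y ≡ true → ¬ OnCycle C y → OnCycle C z → M x z ≡ false
unmatched-to-cycle {M = M} PM C {x} {y} {z} xy y∉C z∈C with M x z in xz
... | false = refl
... | true  = ⊥-elim (y∉C (subst (OnCycle C) (PerfectMatching.disjoint PM x z y xz xy) z∈C))

∸-step : ∀ {m s} → s < m → m ∸ s ≡ suc (m ∸ suc s)
∸-step {suc m} {zero}  _       = refl
∸-step {suc m} {suc s} (s≤s h) = ∸-step h

module _ {n} {G : Graph n} {M : Fin n → Fin n → Bool} {C : AltCycle G M} {v w : Fin n}
         (P : ClosedAltPathAvoiding G M C v w) where

  private module P = ClosedAltPathAvoiding P
  open P using (len; p)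

  path-phase : ∀ s → s < len → M (p s) (p (suc s)) ≡ even s
  path-phase = phase len (λ s → M (p s) (p (suc s))) P.alt P.firstM

  private
    len-1 : suc (len ∸ 1) ≡ len
    len-1 = m+[n∸m]≡n P.len≥1

    -- The last edge p_{len-1}p_len is in M, so len - 1 is even.
    last-even : even (len ∸ 1) ≡ true
    last-even = trans (sym (path-phase (len ∸ 1) (subst (len ∸ 1 <_) len-1 ≤-refl)))
                      (subst (λ z → M (p (len ∸ 1)) (p z) ≡ true) (sym len-1) P.lastM)

  path-odd : ∃ λ t → len ≡ suc (2 * t)
  path-odd with even⇒double (len ∸ 1) last-even
  ... | t , e = t , trans (sym len-1) (cong suc e)

  even-len : even len ≡ false
  even-len = trans (cong even (proj₂ path-odd)) (cong not (even-double (proj₁ path-odd)))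

  -- In a proper 2-colouring, the ends of P (at odd distance) differ in colour.
  ends-differ : (c : Fin n → Bool) → (∀ x y → Edge G x y → c x ≢ c y) → c v ≢ c w
  ends-differ c proper cv≡cw = not-¬ refl (begin
    c (p 0)                                     ≡⟨ cong c P.start ⟩
    c v                                         ≡⟨ cv≡cw ⟩
    c w                                         ≡⟨ cong c (sym P.end) ⟩
    c (p len)                                   ≡⟨ colours len ≤-refl ⟩
    (if even len then c (p 0) else not (c (p 0))) ≡⟨ cong (λ b → if b then c (p 0) else not (c (p 0))) even-len ⟩
    not (c (p 0))                               ∎)
    where
    open ≡-Reasoning
    colours : ∀ s → s < suc len → c (p s) ≡ (if even s then c (p 0) else not (c (p 0)))
    colours = alternating (suc len) (λ s → c (p s))
                (λ x h → proper (p x) (p (suc x)) (P.edges x (s≤s⁻¹ h)))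

  retarget : (C' : AltCycle G M) → (∀ {x} → OnCycle C' x → OnCycle C x) →
             ClosedAltPathAvoiding G M C' v w
  retarget C' sub = record
    { len = len ; len≥1 = P.len≥1 ; p = p ; start = P.start ; end = P.end
    ; distinct = P.distinct ; edges = P.edges ; alt = P.alt ; firstM = P.firstM ; lastM = P.lastM
    ; avoids = λ s s≤len x∈C' → P.avoids s s≤len (sub x∈C')
    }

  reverse : PerfectMatching G M → ClosedAltPathAvoiding G M C w v
  reverse PM = record
    { len      = len
    ; len≥1    = P.len≥1
    ; p        = λ s → p (len ∸ s)
    ; start    = P.end
    ; end      = trans (cong p (n∸n≡0 len)) P.start
    ; distinct = λ i j i≤len j≤len e →
        ∸-cancelˡ-≡ i≤len j≤len (P.distinct _ _ (m∸n≤m len i) (m∸n≤m len j) e)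
    ; edges    = λ s s<len → subst (λ z → Edge G (p z) (p (len ∸ suc s))) (sym (∸-step s<len))
                                   (edge-sym G (P.edges (len ∸ suc s) (before s<len)))
    ; alt      = alt-reversed
    ; firstM   = trans (symM _ _) P.lastM
    ; lastM    = subst₂ (λ x y → M (p x) (p y) ≡ true) (sym (m∸[m∸n]≡n P.len≥1)) (sym (n∸n≡0 len))
                        (trans (symM _ _) P.firstM)
    ; avoids   = λ s _ → P.avoids (len ∸ s) (m∸n≤m len s)
    }
    where
    open PerfectMatching PM using (symM)
    before : ∀ {s} → s < len → len ∸ suc s < len
    before {s} s<len = ≤-trans (≤-reflexive (sym (∸-step s<len))) (m∸n≤m len s)
    alt-backwards : ∀ k → suc k < len → M (p (suc (suc k))) (p (suc k)) ≢ M (p (suc k)) (p k)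
    alt-backwards k h e = P.alt k h (trans (symM _ _) (trans (sym e) (symM _ _)))
    alt-reversed : ∀ s → suc s < len →
                   M (p (len ∸ s)) (p (len ∸ suc s)) ≢ M (p (len ∸ suc s)) (p (len ∸ suc (suc s)))
    alt-reversed s h = subst₂ (λ x y → M (p x) (p y) ≢ M (p y) (p (len ∸ suc (suc s))))
                              (sym (trans (∸-step (<-trans (n<1+n s) h)) (cong suc (∸-step h))))
                              (sym (∸-step h))
                              (alt-backwards (len ∸ suc (suc s))
                                (subst (_< len) (∸-step h) (before (<-trans (n<1+n s) h))))

Step : ∀ {n} → Graph n → (Fin n → Fin n → Bool) → Fin n → Fin n → ℕ → Set
Step G M x y r = Edge G x y × M x y ≡ even r

close-up : ∀ {n} {G : Graph n} {M : Fin n → Fin n → Bool} (H : ℕ) → 2 ≤ H → (f : ℕ → Fin n) →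
           (∀ r r' → r < 2 * H → r' < 2 * H → f r ≡ f r' → r ≡ r') →
           (∀ r → suc r < 2 * H → Step G M (f r) (f (suc r)) r) →
           (∀ r → suc r ≡ 2 * H → Step G M (f r) (f 0) r) →
           AltCycle G M
close-up {n} {G} {M} H H≥2 f injective step wrap = record
  { half     = H
  ; half≥2   = H≥2
  ; u        = g
  ; periodic = λ j → cong f ([m+n]%n≡m%n j N)
  ; distinct = λ x y x<N y<N e →
      injective x y x<N y<N (subst₂ (λ a b → f a ≡ f b) (m<n⇒m%n≡m x<N) (m<n⇒m%n≡m y<N) e)
  ; edges    = λ j → proj₁ (cyclic-step j)
  ; alt      = λ j e → not-¬ refl (trans (sym (proj₂ (cyclic-step j)))
                                         (trans e (proj₂ (cyclic-step (suc j)))))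
  }
  where
  N : ℕ
  N = 2 * H
  1<N : 1 < N
  1<N = ≤-trans H≥2 (m≤m+n H _)
  instance
    N-nonZero : NonZero N
    N-nonZero = >-nonZero (<-trans z<s 1<N)
  g : ℕ → Fin n
  g j = f (j % N)

  next : ∀ r → r < N → Step G M (f r) (f (suc r % N)) r
  next r r<N with suc r <? N
  ... | yes h = subst (λ z → Step G M (f r) (f z) r) (sym (m<n⇒m%n≡m h)) (step r h)
  ... | no  h = subst (λ z → Step G M (f r) (f z) r) (sym (trans (cong (_% N) last) (n%n≡0 N)))
                      (wrap r last)
    where
    last : suc r ≡ N
    last = ≤∧≮⇒≡ r<N h

  suc-mod : ∀ j → suc j % N ≡ suc (j % N) % N
  suc-mod j = trans (%-distribˡ-+ 1 j N) (cong (λ z → (z + j % N) % N) (m<n⇒m%n≡m 1<N))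

  even-mod : ∀ j → even (j % N) ≡ even j
  even-mod j = sym (begin
    even j                            ≡⟨ cong even (m≡m%n+[m/n]*n j N) ⟩
    even (j % N + j / N * N)          ≡⟨ cong even (reorder (j % N) (j / N) H) ⟩
    even (2 * (j / N * H) + j % N)    ≡⟨ even-2*+ (j / N * H) (j % N) ⟩
    even (j % N)                      ∎)
    where
    open ≡-Reasoning
    reorder : ∀ a q H → a + q * (2 * H) ≡ 2 * (q * H) + a
    reorder = solve-∀

  cyclic-step : ∀ j → Step G M (g j) (g (suc j)) j
  cyclic-step j = subst₂ (λ y b → Edge G (g j) (f y) × M (g j) (f y) ≡ b) (sym (suc-mod j)) (even-mod j)
                         (next (j % N) (m%n<n j N))

-- Let C be an M-alternating cycle whose M-edges are
-- u_{2k}u_{2k+1}, so that its closing edge u_{L-1}u₀ is not in M, and let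
-- P be a closed alternating path from v to w avoiding C with u_{L-1} ~ v and
-- w ~ u₀.  Then  p₀ … p_len u₀ u₁ … u_{L-1}  is a longer alternating cycle:
-- the junction edges are not in M because v and w are matched inside P.
module Splice {n} {G : Graph n} {M : Fin n → Fin n → Bool} (PM : PerfectMatching G M)
              (C : AltCycle G M) (phaseC : ∀ x → M (u C x) (u C (suc x)) ≡ even x)
              {v w : Fin n} (P : ClosedAltPathAvoiding G M C v w)
              (last∼v : Edge G (u C (pred (2 * half C))) v) (w∼first : Edge G w (u C 0)) where

  private
    module P = ClosedAltPathAvoiding P
    open P using (len; p)
    open PerfectMatching PM using (symM)

    -- P has length 2t + 1, so the spliced cycle has 2t + 2 + L = 2H vertices.
    t L D H : ℕ
    t = proj₁ (path-odd P)
    L = 2 * half C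
    D = suc len
    H = suc t + half C

    D≡ : D ≡ 2 * suc t
    D≡ = trans (cong suc (proj₂ (path-odd P))) (double-suc t)

    2H≡ : 2 * H ≡ D + L
    2H≡ = trans (distrib (suc t) (half C)) (cong (_+ L) (sym D≡))
      where
      distrib : ∀ a b → 2 * (a + b) ≡ 2 * a + 2 * b
      distrib = solve-∀

    0<L : 0 < L
    0<L = >-nonZero⁻¹ L {{length-nonZero C}}

    join : ℕ → Fin n
    join r with r <? D
    ... | yes _ = p r
    ... | no  _ = u C (r ∸ D)

    join-path : ∀ {r} → r < D → join r ≡ p r
    join-path {r} r<D with r <? D
    ... | yes _   = refl
    ... | no  r≮D = contradiction r<D r≮D

    join-cycle : ∀ s → join (D + s) ≡ u C s
    join-cycle s with D + s <? D
    ... | yes h = contradiction h (m+n≮m D s)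
    ... | no  _ = cong (u C) (m+n∸m≡n D s)

    data Piece (r : ℕ) : Set where
      on-path  : r < D → Piece r
      on-cycle : ∀ s → r ≡ D + s → Piece r

    piece : ∀ r → Piece r
    piece r with r <? D
    ... | yes r<D = on-path r<D
    ... | no  r≮D = on-cycle (r ∸ D) (sym (m+[n∸m]≡n (≮⇒≥ r≮D)))

    on-C : ∀ {s} → D + s < 2 * H → s < L
    on-C {s} h = +-cancelˡ-< D s L (subst (D + s <_) 2H≡ h)

    -- Vertices are distinct along P and along C, and P avoids C.
    injective : ∀ r r' → r < 2 * H → r' < 2 * H → join r ≡ join r' → r ≡ r'
    injective r r' r<N r'<N e with piece r | piece r'
    ... | on-path h | on-path h' =
      P.distinct r r' (s≤s⁻¹ h) (s≤s⁻¹ h') (trans (sym (join-path h)) (trans e (join-path h')))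
    ... | on-path h | on-cycle s' refl =
      ⊥-elim (P.avoids r (s≤s⁻¹ h)
                (s' , on-C r'<N , trans (sym (join-cycle s')) (trans (sym e) (join-path h))))
    ... | on-cycle s refl | on-path h' =
      ⊥-elim (P.avoids r' (s≤s⁻¹ h')
                (s , on-C r<N , trans (sym (join-cycle s)) (trans e (join-path h'))))
    ... | on-cycle s refl | on-cycle s' refl =
      cong (D +_) (distinct C s s' (on-C r<N) (on-C r'<N)
                     (trans (sym (join-cycle s)) (trans e (join-cycle s'))))

    -- v and w are matched inside P, hence not to vertices of C.
    v-unmatched : ∀ j → j < L → M (u C j) v ≡ false
    v-unmatched j j<L = trans (symM _ _)
      (unmatched-to-cycle PM C (subst (λ x → M x (p 1) ≡ true) P.start P.firstM)
                               (P.avoids 1 P.len≥1) (j , j<L , refl))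

    w-unmatched : M w (u C 0) ≡ false
    w-unmatched =
      unmatched-to-cycle PM C (subst (λ x → M x (p (len ∸ 1)) ≡ true) P.end (trans (symM _ _) P.lastM))
                              (P.avoids (len ∸ 1) (m∸n≤m len 1)) (0 , 0<L , refl)

    -- Steps along C keep their parity since D is even; steps along P follow
    -- its phase; the junction edge w u₀ and the wrap-around edge u_{L-1} v
    -- are not in M and sit at odd positions.
    cycle-step : ∀ s → Step G M (join (D + s)) (join (suc (D + s))) (D + s)
    cycle-step s =
      subst (λ z → Step G M (join (D + s)) (join z) (D + s)) (+-suc D s)
        (subst₂ (λ x y → Step G M x y (D + s)) (sym (join-cycle s)) (sym (join-cycle (suc s)))
          (edges C s , trans (phaseC s) (sym (trans (cong (λ d → even (d + s)) D≡) (even-2*+ (suc t) s)))))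

    junction : Step G M (join len) (join D) len
    junction = subst₂ (λ x y → Step G M x y len) (sym (trans (join-path ≤-refl) P.end))
                      (sym (trans (cong join (sym (+-identityʳ D))) (join-cycle 0)))
                      (w∼first , trans w-unmatched (sym (even-len P)))

    path-step : ∀ r → r < D → Dec (suc r < D) → Step G M (join r) (join (suc r)) r
    path-step r h (yes h') = subst₂ (λ x y → Step G M x y r) (sym (join-path h)) (sym (join-path h'))
                                    (P.edges r (s≤s⁻¹ h') , path-phase P r (s≤s⁻¹ h'))
    path-step r h (no h')  = subst (λ k → Step G M (join k) (join (suc k)) k)
                                   (sym (suc-injective (≤∧≮⇒≡ h h'))) junction

    step : ∀ r → suc r < 2 * H → Step G M (join r) (join (suc r)) r
    step r _ with piece r
    ... | on-cycle s refl = cycle-step s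
    ... | on-path h       = path-step r h (suc r <? D)

    wrap : ∀ r → suc r ≡ 2 * H → Step G M (join r) (join 0) r
    wrap r last with piece r
    ... | on-path h = contradiction (subst (_≤ D) (trans last 2H≡) h) (<⇒≱ (m<m+n D 0<L))
    ... | on-cycle s refl =
      subst₂ (λ x y → Step G M x y (D + s)) (sym (trans (join-cycle s) (cong (u C) s≡)))
             (sym (trans (join-path z<s) P.start))
             (last∼v , trans (v-unmatched (pred L) pred-L<L) (sym (even-pred (D + s) H last)))
      where
      s≡ : s ≡ pred L
      s≡ = cong pred (+-cancelˡ-≡ D (suc s) L (trans (+-suc D s) (trans last 2H≡)))
      pred-L<L : pred L < L
      pred-L<L = ≤-reflexive (suc-pred L {{length-nonZero C}})

  spliced : AltCycle G M
  spliced = close-up H (≤-trans (half≥2 C) (m≤n+m (half C) (suc t))) join injective step wrap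

  longer : half C < half spliced
  longer = s≤s (m≤n+m (half C) t)

-- With C′ the rotation of C starting at u_{2i+1}, the rung
-- u_{2i}u_{2i+1} becomes the closing edge of C′, so an edge pair
-- u_{2i} ~ x, u_{2i+1} ~ y for the ends x, y of a closed alternating path
-- avoiding C would splice into an alternating cycle longer than C.
lemma1p3 : ∀ {n : ℕ} (G : Graph n) → Connected G →
           ∀ (M : Fin n → Fin n → Bool) → PerfectMatching G M →
           ∀ (C : AltCycle G M) → Longest C →
           (∀ i → M (u C (2 * i + 1)) (u C (2 * i + 2)) ≡ true) →
           ∀ (v w : Fin n) → ClosedAltPathAvoiding G M C v w →
           ∀ i → i < half C →
           (Bipartite G → eCount G (u C (2 * i) ∷ u C (2 * i + 1) ∷ []) (v ∷ w ∷ []) ≤ 1)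
           × (¬ Bipartite G → eCount G (u C (2 * i) ∷ u C (2 * i + 1) ∷ []) (v ∷ w ∷ []) ≤ 2)
lemma1p3 {n} G _ M PM C longest rungs-in-M v w P i _ = bipartite-case , general-case
  where
  a′ b′ : Fin n
  a′ = u C (2 * i)
  b′ = u C (2 * i + 1)

  rung : Edge G a′ b′
  rung = subst (λ k → Edge G a′ (u C k)) (+-comm 1 (2 * i)) (edges C (2 * i))

  C′ : AltCycle G M
  C′ = rotate C (suc (2 * i))

  phase′ : ∀ x → M (u C′ x) (u C′ (suc x)) ≡ even x
  phase′ = cycle-phase C′ (subst₂ (λ x y → M (u C x) (u C y) ≡ true)
                                  (+-comm (2 * i) 1) (+-comm (2 * i) 2) (rungs-in-M i))

  no-cross : ∀ {x y} → ClosedAltPathAvoiding G M C x y → Edge G a′ x → Edge G b′ y → ⊥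
  no-cross {x} {y} Q a′∼x b′∼y = <⇒≱ S.longer (longest S.spliced)
    where
    module S = Splice PM C′ phase′ (retarget Q C′ (rotate-onCycle C (suc (2 * i))))
                 (subst (λ z → Edge G z x) (sym (rotate-last C (2 * i))) a′∼x)
                 (subst (λ k → Edge G y (u C k)) (+-comm (2 * i) 1) (edge-sym G b′∼y))

  cross-vw : Exclusive (adj G a′ v) (adj G b′ w)
  cross-vw = no-cross P

  cross-wv : Exclusive (adj G a′ w) (adj G b′ v)
  cross-wv = no-cross (reverse P PM)

  general-case : ¬ Bipartite G → eCount G (a′ ∷ b′ ∷ []) (v ∷ w ∷ []) ≤ 2
  general-case _ = two-pairs _ _ _ _ cross-vw cross-wv

  bipartite-case : Bipartite G → eCount G (a′ ∷ b′ ∷ []) (v ∷ w ∷ []) ≤ 1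
  bipartite-case (c , proper) =
    at-most-one ((split-ends ∷ split-rung ∷ cross-vw ∷ [])
             ∷ (cross-wv ∷ split-rung ∷ [])
             ∷ (split-ends ∷ [])
             ∷ [] ∷ [])
    where
    split-rung : ∀ {x} → Edge G a′ x → Edge G b′ x → ⊥
    split-rung a′∼x b′∼x = proper a′ b′ rung (same-side G c proper (edge-sym G a′∼x) (edge-sym G b′∼x))
    split-ends : ∀ {y} → Edge G y v → Edge G y w → ⊥
    split-ends y∼v y∼w = ends-differ P c proper (same-side G c proper y∼v y∼w)
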